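{- If $\chi_I\vdash c:\chi_O$, then $\chi_O\subseteq\chi_I\cup\mathrm{fv}(c)$.
   Context: Restrictions: $c ::= p_O(t_1,\ldots,t_n)\mid\vec x\not\in S\mid\top\mid\bot\mid c_1\wedge c_2\mid c_1\vee c_2\mid\exists x.c$, where $p_O$ ranges over objective predicates, each with a set $I(p_O)$ of input argument positions and a set $O(p_O)$ of output positions, and $\vec x\not\in S$ is a special atom ($S$ a finite set of tuples of ground terms) all of whose positions are input. $\mathrm{fv}(c)$ denotes the free variables of $c$. Mode judgment $\chi_I\vdash c:\chi_O$ ($\chi_I,\chi_O$ sets of variables), defined inductively: $\chi_I\vdash p_O(t_1,\ldots,t_n):\chi_I\cup\bigcup_{j\in O(p_O)}\mathrm{fv}(t_j)$ provided $\mathrm{fv}(t_k)\subseteq\chi_I$ for all $k\in I(p_O)$; $\chi_I\vdash\top:\chi_I$; $\chi_I\vdash\bot:\chi_I$; if $\chi_I\vdash c_1:\chi$ and $\chi\vdash c_2:\chi_O$ then $\chi_I\vdash c_1\wedge c_2:\chi_O$; if $\chi_I\vdash c_1:\chi_1$ and $\chi_I\vdash c_2:\chi_2$ then $\chi_I\vdash c_1\vee c_2:\chi_1\cap\chi_2$; if $\chi_I\vdash c:\chi_O$ then $\chi_I\vdash\exists x.c:\chi_O\backslash\{x\}$. -}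

module Defs where

open import Level using (0ℓ)
open import Data.Nat using (ℕ)
open import Data.Fin using (Fin)
open import Data.Empty using (⊥)
open import Data.List using (List)
open import Data.List.Relation.Unary.Any using (Any)
open import Data.Vec using (Vec; lookup)
open import Data.Product using (Σ; ∃; _×_)
open import Data.Sum using (_⊎_)
open import Relation.Unary using (Pred; _∪_; _∩_; _⊆_)
open import Relation.Binary.PropositionalEquality using (_≡_; _≢_)

Var : Set
Var = ℕ

VarSet : Set₁
VarSet = Pred Var 0ℓ

_∖_ : VarSet → Var → VarSet
(χ ∖ x) y = χ y × y ≢ x

record Signature : Set₁ where
  field
    FunSym  : Set
    PredSym : Set
    arity   : PredSym → ℕ
    Inp     : (p : PredSym) → Pred (Fin (arity p)) 0ℓ
    Out     : (p : PredSym) → Pred (Fin (arity p)) 0ℓ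

module Syntax (Sig : Signature) where
  open Signature Sig

  data Term (V : Set) : Set where
    var : V → Term V
    app : FunSym → List (Term V) → Term V

  GroundTerm : Set
  GroundTerm = Term ⊥

  data _∈fvT_ (x : Var) : Term Var → Set where
    here : x ∈fvT var x
    arg  : ∀ {f ts} → Any (x ∈fvT_) ts → x ∈fvT app f ts

  fvT : Term Var → VarSet
  fvT t x = x ∈fvT t

  -- Restrictions
  --   c ::= p_O(t_1..t_n) | x⃗ ∉ S | ⊤ | ⊥ | c ∧ c | c ∨ c | ∃x.c
  data Restr : Set where
    atom  : (p : PredSym) → Vec (Term Var) (arity p) → Restr
    notIn : ∀ {k} → Vec Var k → List (Vec GroundTerm k) → Restr
    top   : Restr
    bot   : Restr
    _∧ᶜ_  : Restr → Restr → Restr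
    _∨ᶜ_  : Restr → Restr → Restr
    exᶜ   : Var → Restr → Restr

  fv : Restr → VarSet
  fv (atom p ts)  y = ∃ λ (j : Fin (arity p)) → fvT (lookup ts j) y
  fv (notIn xs S) y = ∃ λ j → lookup xs j ≡ y
  fv top          y = ⊥
  fv bot          y = ⊥
  fv (c₁ ∧ᶜ c₂)   = fv c₁ ∪ fv c₂
  fv (c₁ ∨ᶜ c₂)   = fv c₁ ∪ fv c₂
  fv (exᶜ x c)    = fv c ∖ x

  outVars : (p : PredSym) → Vec (Term Var) (arity p) → VarSet
  outVars p ts y = ∃ λ (j : Fin (arity p)) → Out p j × fvT (lookup ts j) y

  -- Mode judgment  χ_I ⊢ c : χ_O.
  -- The special atom x⃗ ∉ S has all positions input (and none output).
  data _⊢_∶_ : VarSet → Restr → VarSet → Set₁ where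
    m-atom  : ∀ {χI p ts} →
              (∀ k → Inp p k → fvT (lookup ts k) ⊆ χI) →
              χI ⊢ atom p ts ∶ (χI ∪ outVars p ts)
    m-notIn : ∀ {χI k} {xs : Vec Var k} {S} →
              (∀ j → χI (lookup xs j)) →
              χI ⊢ notIn xs S ∶ χI
    m-top   : ∀ {χI} → χI ⊢ top ∶ χI
    m-bot   : ∀ {χI} → χI ⊢ bot ∶ χI
    m-and   : ∀ {χI χ χO c₁ c₂} →
              χI ⊢ c₁ ∶ χ → χ ⊢ c₂ ∶ χO → χI ⊢ (c₁ ∧ᶜ c₂) ∶ χO
    m-or    : ∀ {χI χ₁ χ₂ c₁ c₂} →
              χI ⊢ c₁ ∶ χ₁ → χI ⊢ c₂ ∶ χ₂ → χI ⊢ (c₁ ∨ᶜ c₂) ∶ (χ₁ ∩ χ₂)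
    m-ex    : ∀ {χI χO x c} →
              χI ⊢ c ∶ χO → χI ⊢ exᶜ x c ∶ (χO ∖ x)

-- Induction on the mode derivation: each rule either passes χI through or adds
-- variables occurring in c. For c₁ ∧ c₂ the intermediate set χ is itself
-- bounded by χI ∪ fv c₁, so a variable output by c₂ lies in χI ∪ fv c₁ ∪ fv c₂.
module Submission where

open import Defs
open import Function using (_∘_)
open import Relation.Unary using (Pred; _⊆_; _∪_)
open import Data.Sum using (inj₁; inj₂; [_,_]; map₂)
open import Data.Product using (_,_; proj₁)

∪-assoc-⊆ : ∀ {a ℓ} {A : Set a} {P Q R : Pred A ℓ} → (P ∪ Q) ∪ R ⊆ P ∪ (Q ∪ R)
∪-assoc-⊆ = [ map₂ inj₁ , inj₂ ∘ inj₂ ]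

module ModeProperties (Sig : Signature) where
  open Syntax Sig

  outVars⊆fv : ∀ p ts → outVars p ts ⊆ fv (atom p ts)
  outVars⊆fv p ts (j , _ , y∈tⱼ) = j , y∈tⱼ

  output⊆input∪fv : ∀ {χI χO c} → χI ⊢ c ∶ χO → χO ⊆ (χI ∪ fv c)
  output⊆input∪fv (m-atom {p = p} {ts} _) = map₂ (outVars⊆fv p ts)
  output⊆input∪fv (m-notIn _)             = inj₁
  output⊆input∪fv m-top                   = inj₁
  output⊆input∪fv m-bot                   = inj₁
  output⊆input∪fv (m-and {χI = χI} {c₁ = c₁} {c₂} d₁ d₂) =
    ∪-assoc-⊆ {P = χI} {fv c₁} {fv c₂} ∘
    [ inj₁ ∘ output⊆input∪fv d₁ , inj₂ ] ∘ output⊆input∪fv d₂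
  output⊆input∪fv (m-or d₁ _)   = map₂ inj₁ ∘ output⊆input∪fv d₁ ∘ proj₁
  output⊆input∪fv (m-ex d) (y∈χO , y≢x) =
    map₂ (_, y≢x) (output⊆input∪fv d y∈χO)

mainTheorem7 : (Sig : Signature) → let open Syntax Sig in
    ∀ {χI χO : VarSet} {c : Restr} →
    χI ⊢ c ∶ χO → χO ⊆ (χI ∪ fv c)
mainTheorem7 Sig = ModeProperties.output⊆input∪fv Sig
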